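{- Let $S$ be as in the context and let $U$ be the subspace of $F_2^n$ spanned by $\Pi$. If $|\Pi_1|$ is odd, then $\Pi$ is a basis of $U$. If $|\Pi_1|$ is even, then $\Pi\setminus\{\overline j\}$ is a basis of $U$ for any $\overline j\in\Pi$, and moreover $\widetilde s_n\notin U$.
   Context: $S$ is a finite simple connected graph with vertex set $\{s_1,\dots,s_n\}$, $n\ge2$, and edge set $R$, such that $s_1,\dots,s_{n-1}$ is an induced path; $s_n$ is adjacent to some of $s_1,\dots,s_{n-1}$. $\widetilde s$ is the characteristic vector in $F_2^n$ (coordinates indexed by vertices) of vertex $s$. The flipping move of $s$ is $\mathbf s\in\mathrm{Mat}_n(F_2)$ with $\mathbf s_{ab}=1$ if $a=b$, or if $b=s$ and $ab\in R$, and $0$ otherwise. $\overline1=\widetilde s_1$ and $\overline{i+1}=\mathbf{s_i}\cdots\mathbf{s_1}\overline1$ for $1\le i\le n-1$. $\Pi=\{\overline1,\dots,\overline n\}$, $\Pi_0=\{\overline i\in\Pi:\langle\overline i,\widetilde s_n\rangle=0\}$ (dot product over $F_2$), and $\Pi_1=\Pi\setminus\Pi_0$. -}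

module Defs where

open import Data.Bool using (Bool; true; false; _∧_; _∨_; _xor_)
open import Data.Nat using (ℕ; zero; suc; _+_; _*_; _≤_)
open import Data.Fin using (Fin; zero; suc; inject₁; fromℕ; toℕ; _≟_; punchIn)
open import Data.List using (List; []; _∷_; map)
open import Data.Product using (Σ; ∃; _×_)
open import Data.Sum using (_⊎_)
open import Relation.Nullary using (¬_)
open import Relation.Nullary.Decidable using (⌊_⌋)
open import Relation.Binary.PropositionalEquality using (_≡_)
open import Function.Bundles using (_⇔_)

-- F₂ = Bool with xor as addition and ∧ as multiplication.
-- Vectors in F₂ⁿ are functions Fin n → Bool (coordinates indexed by vertices).
Vec₂ : ℕ → Set
Vec₂ n = Fin n → Bool

Σ₂ : ∀ {n} → (Fin n → Bool) → Bool
Σ₂ {zero}  f = false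
Σ₂ {suc n} f = f zero xor Σ₂ (λ i → f (suc i))

count : ∀ {n} → (Fin n → Bool) → ℕ
count {zero}  f = 0
count {suc n} f = (if-true (f zero)) + count (λ i → f (suc i))
  where
  if-true : Bool → ℕ
  if-true true  = 1
  if-true false = 0

Odd : ℕ → Set
Odd k = Σ ℕ λ q → k ≡ suc (2 * q)

Even : ℕ → Set
Even k = Σ ℕ λ q → k ≡ 2 * q

_≈_ : ∀ {n} → Vec₂ n → Vec₂ n → Set
u ≈ v = ∀ a → u a ≡ v a

0v : ∀ {n} → Vec₂ n
0v _ = false

⟨_,_⟩ : ∀ {n} → Vec₂ n → Vec₂ n → Bool
⟨ u , v ⟩ = Σ₂ (λ a → u a ∧ v a)

chr : ∀ {n} → Fin n → Vec₂ n
chr s a = ⌊ a ≟ s ⌋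

Mat₂ : ℕ → Set
Mat₂ n = Fin n → Fin n → Bool

_·_ : ∀ {n} → Mat₂ n → Vec₂ n → Vec₂ n
(M · v) a = Σ₂ (λ b → M a b ∧ v b)

Adj : ℕ → Set
Adj n = Fin n → Fin n → Bool

data Reach {n} (adj : Adj n) (a : Fin n) : Fin n → Set where
  here : Reach adj a a
  step : ∀ {b c} → Reach adj a b → adj b c ≡ true → Reach adj a c

Connected : ∀ {n} → Adj n → Set
Connected adj = ∀ a b → Reach adj a b

-- The graph S: vertices s₁,…,sₙ are 0,…,m of Fin (suc m) (n = suc m);
-- sₙ = fromℕ m; s₁,…,s_{n-1} are inject₁ i for i : Fin m.
record SGraph (m : ℕ) : Set where
  field
    adj       : Adj (suc m)
    symmetric : ∀ a b → adj a b ≡ adj b a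
    loopless  : ∀ a → adj a a ≡ false
    connected : Connected adj
    inducedPath : ∀ (i j : Fin m) →
      (adj (inject₁ i) (inject₁ j) ≡ true) ⇔ (suc (toℕ i) ≡ toℕ j ⊎ suc (toℕ j) ≡ toℕ i)

flipMove : ∀ {n} → Adj n → Fin n → Mat₂ n
flipMove adj s a b = ⌊ a ≟ b ⌋ ∨ (⌊ b ≟ s ⌋ ∧ adj a b)

down : ∀ {n} → Fin n → List (Fin n)
down zero    = []
down (suc k) = map inject₁ (k ∷ down k)

applyFlips : ∀ {n} → Adj n → List (Fin n) → Vec₂ n → Vec₂ n
applyFlips adj []       v = v
applyFlips adj (s ∷ ss) v = flipMove adj s · applyFlips adj ss v

-- Π as a family indexed by Fin n (0-based): bar k is \overline{k+1},
-- i.e. bar 0 = s̃₁ and bar i = s_i ⋯ s_1 s̃₁ (1-based vertex names).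
bar : ∀ {n} → Adj (suc n) → Fin (suc n) → Vec₂ (suc n)
bar adj k = applyFlips adj (down k) (chr zero)

lincomb : ∀ {k n} → (Fin k → Bool) → (Fin k → Vec₂ n) → Vec₂ n
lincomb c f a = Σ₂ (λ i → c i ∧ f i a)

InSpan : ∀ {k n} → (Fin k → Vec₂ n) → Vec₂ n → Set
InSpan f v = ∃ λ c → lincomb c f ≈ v

LinIndep : ∀ {k n} → (Fin k → Vec₂ n) → Set
LinIndep f = ∀ c → lincomb c f ≈ 0v → ∀ i → c i ≡ false

IsBasisOf : ∀ {k n} → (Vec₂ n → Set) → (Fin k → Vec₂ n) → Set
IsBasisOf W f = (∀ i → W (f i)) × LinIndep f × (∀ v → W v → InSpan f v)

card-Π₁ : ∀ {m} → Adj (suc m) → ℕ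
card-Π₁ {m} adj = count (λ i → ⟨ bar adj i , chr (fromℕ m) ⟩)

-- On the path coordinates s₁,…,s_{n-1} the vectors of Π are s̃₁ and s̃ᵢ + s̃ᵢ₊₁ (each flip
-- s_i moves the second nonzero entry one step along the path), so a linear combination of
-- Π vanishes there exactly when all its coefficients are equal. Hence the only possible
-- relation among Π is the sum of all its members, whose sₙ-coordinate is the parity of
-- |Π₁|. If |Π₁| is odd Π is independent; if it is even, the sum of Π is zero, so any one
-- member is redundant while the rest are independent, and s̃ₙ, which vanishes on the path
-- but not at sₙ, cannot be a combination of Π.
module Submission where

open import Algebra.Bundles using (CommutativeRing)
open import Data.Bool using (Bool; true; false; not; _∧_; _∨_; _xor_; T)
open import Data.Bool.Properties
  using (xor-∧-commutativeRing; xor-identityʳ; xor-same; ∧-comm; ∧-identityʳ; ∧-zeroʳ;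
         ∧-distribʳ-xor; not-involutive; T-≡; T-∨; ⇔→≡)
open import Algebra.Properties.CommutativeSemigroup
  (CommutativeRing.+-commutativeSemigroup xor-∧-commutativeRing) using (interchange)
open import Data.Empty using (⊥; ⊥-elim)
open import Data.Fin using (Fin; zero; suc; fromℕ; inject₁; punchIn; toℕ; _≟_)
open import Data.Fin.Induction using (<-weakInduction; >-weakInduction)
open import Data.Fin.Properties using (toℕ-inject₁; fromℕ≢inject₁)
open import Data.List using (map; _∷_)
open import Data.Nat using (ℕ; zero; suc; _+_; _*_; _≤_; _≡ᵇ_)
open import Data.Nat.Properties using (≡ᵇ⇒≡; ≡⇒≡ᵇ; +-suc; +-identityʳ)
open import Data.Product using (_×_; _,_)
open import Data.Sum using (_⊎_)
open import Data.Sum.Function.Propositional using (_⊎-⇔_)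
open import Data.Vec.Functional using (insertAt)
open import Data.Vec.Functional.Properties using (insertAt-lookup; insertAt-punchIn)
open import Function using (_∘_)
open import Function.Bundles using (_⇔_; mk⇔)
open import Function.Construct.Composition using (_⇔-∘_)
open import Function.Construct.Symmetry using (⇔-sym)
open import Relation.Binary.PropositionalEquality
open import Relation.Nullary using (¬_; yes; no)
open import Relation.Nullary.Decidable using (⌊_⌋; ⌊⌋-map′; isYes≗does; dec-true; dec-false)

open import Defs

Σ₂-cong : ∀ {n} {f g : Fin n → Bool} → (∀ i → f i ≡ g i) → Σ₂ f ≡ Σ₂ g
Σ₂-cong {zero}  f≗g = refl
Σ₂-cong {suc n} f≗g = cong₂ _xor_ (f≗g zero) (Σ₂-cong (f≗g ∘ suc))

Σ₂-xor : ∀ {n} (f g : Fin n → Bool) → Σ₂ (λ i → f i xor g i) ≡ Σ₂ f xor Σ₂ g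
Σ₂-xor {zero}  f g = refl
Σ₂-xor {suc n} f g = trans (cong ((f zero xor g zero) xor_) (Σ₂-xor (f ∘ suc) (g ∘ suc)))
                           (interchange (f zero) (g zero) (Σ₂ (f ∘ suc)) (Σ₂ (g ∘ suc)))

Σ₂-false : ∀ {n} → Σ₂ {n} (λ _ → false) ≡ false
Σ₂-false {zero}  = refl
Σ₂-false {suc n} = Σ₂-false {n}

Σ₂-∧ˡ : ∀ {n} x (f : Fin n → Bool) → Σ₂ (λ i → x ∧ f i) ≡ x ∧ Σ₂ f
Σ₂-∧ˡ     true  f = refl
Σ₂-∧ˡ {n} false f = Σ₂-false {n}

Σ₂-pick : ∀ {n} (t : Fin n) (f : Fin n → Bool) → Σ₂ (λ i → ⌊ i ≟ t ⌋ ∧ f i) ≡ f t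
Σ₂-pick {suc n} zero    f = trans (cong (f zero xor_) (Σ₂-false {n})) (xor-identityʳ (f zero))
Σ₂-pick {suc n} (suc t) f =
  trans (Σ₂-cong (λ i → cong (_∧ f (suc i)) (⌊⌋-map′ _ _ (i ≟ t)))) (Σ₂-pick t (f ∘ suc))

Σ₂-punchIn : ∀ {n} (j : Fin (suc n)) (f : Fin (suc n) → Bool) →
             Σ₂ f ≡ f j xor Σ₂ (f ∘ punchIn j)
Σ₂-punchIn         zero    f = refl
Σ₂-punchIn {suc n} (suc j) f =
  trans (cong (f zero xor_) (Σ₂-punchIn j (f ∘ suc))) (xor-swap (f zero) (f (suc j)) _)
  where
  xor-swap : ∀ x y z → x xor (y xor z) ≡ y xor (x xor z)
  xor-swap true  true  z = refl
  xor-swap true  false z = refl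
  xor-swap false y     z = refl

parity : ℕ → Bool
parity zero    = false
parity (suc k) = not (parity k)

Σ₂≡parity-count : ∀ {n} (f : Fin n → Bool) → Σ₂ f ≡ parity (count f)
Σ₂≡parity-count {zero}  f = refl
Σ₂≡parity-count {suc n} f with f zero
... | true  = cong not (Σ₂≡parity-count (f ∘ suc))
... | false = Σ₂≡parity-count (f ∘ suc)

parity-double : ∀ q → parity (2 * q) ≡ false
parity-double q = trans (cong (parity ∘ (q +_)) (+-identityʳ q)) (parity-+-self q)
  where
  parity-+-self : ∀ q → parity (q + q) ≡ false
  parity-+-self zero    = refl
  parity-+-self (suc q) rewrite +-suc q q = trans (not-involutive _) (parity-+-self q)

parity-even : ∀ {k} → Even k → parity k ≡ false
parity-even (q , refl) = parity-double q

parity-odd : ∀ {k} → Odd k → parity k ≡ true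
parity-odd (q , refl) = cong not (parity-double q)

module _ {k n : ℕ} (f : Fin k → Vec₂ n) where

  inSpan-member : ∀ i → InSpan f (f i)
  inSpan-member i = (λ l → ⌊ l ≟ i ⌋) , (λ a → Σ₂-pick i (λ l → f l a))

  lincomb-constant : ∀ {c x} → (∀ i → c i ≡ x) → ∀ a →
                     lincomb c f a ≡ x ∧ lincomb (λ _ → true) f a
  lincomb-constant {x = x} c≗x a =
    trans (Σ₂-cong (λ i → cong (_∧ f i a) (c≗x i))) (Σ₂-∧ˡ x (λ i → f i a))

  lincomb-not : ∀ c a → lincomb (not ∘ c) f a ≡ lincomb c f a xor lincomb (λ _ → true) f a
  lincomb-not c a =
    trans (Σ₂-cong (λ i → not-∧ (c i) (f i a))) (Σ₂-xor (λ i → c i ∧ f i a) (λ i → f i a))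
    where
    not-∧ : ∀ x y → not x ∧ y ≡ (x ∧ y) xor y
    not-∧ true  y = sym (xor-same y)
    not-∧ false y = refl

module _ {k n : ℕ} (f : Fin (suc k) → Vec₂ n) (j : Fin (suc k)) where

  lincomb-punchIn : ∀ c → c j ≡ false → ∀ a →
                    lincomb c f a ≡ lincomb (c ∘ punchIn j) (f ∘ punchIn j) a
  lincomb-punchIn c cj≡false a =
    trans (Σ₂-punchIn j (λ i → c i ∧ f i a))
          (cong (λ x → x ∧ f j a xor lincomb (c ∘ punchIn j) (f ∘ punchIn j) a) cj≡false)

  inSpan-punchIn : lincomb (λ _ → true) f ≈ 0v →
                   ∀ {v} → InSpan f v → InSpan (f ∘ punchIn j) v
  inSpan-punchIn sum≈0 {v} (c , c≈v) with c j in cj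
  ... | false = c ∘ punchIn j , (λ a → trans (sym (lincomb-punchIn c cj a)) (c≈v a))
  ... | true  = not ∘ c ∘ punchIn j , λ a → begin
    lincomb (not ∘ c ∘ punchIn j) (f ∘ punchIn j) a ≡⟨ lincomb-punchIn (not ∘ c) (cong not cj) a ⟨
    lincomb (not ∘ c) f a                            ≡⟨ lincomb-not f c a ⟩
    lincomb c f a xor lincomb (λ _ → true) f a       ≡⟨ cong₂ _xor_ (c≈v a) (sum≈0 a) ⟩
    v a xor false                                    ≡⟨ xor-identityʳ (v a) ⟩
    v a                                              ∎
    where open ≡-Reasoning

ConstantKernel : ∀ {k n} → (Fin (suc k) → Vec₂ n) → Set
ConstantKernel f = ∀ c → lincomb c f ≈ 0v → ∀ i → c i ≡ c zero

module _ {k n : ℕ} (f : Fin (suc k) → Vec₂ n) (kernel : ConstantKernel f) where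

  linIndep-of-sum≉0 : ∀ a → lincomb (λ _ → true) f a ≡ true → LinIndep f
  linIndep-of-sum≉0 a sum≡true c c≈0 i = begin
    c i                                  ≡⟨ kernel c c≈0 i ⟩
    c zero                               ≡⟨ ∧-identityʳ (c zero) ⟨
    c zero ∧ true                        ≡⟨ cong (c zero ∧_) sum≡true ⟨
    c zero ∧ lincomb (λ _ → true) f a    ≡⟨ lincomb-constant f (kernel c c≈0) a ⟨
    lincomb c f a                        ≡⟨ c≈0 a ⟩
    false                                ∎
    where open ≡-Reasoning

  linIndep-punchIn : ∀ j → LinIndep (f ∘ punchIn j)
  linIndep-punchIn j c c≈0 i = begin
    c i                 ≡⟨ insertAt-punchIn c j false i ⟨
    c′ (punchIn j i)    ≡⟨ constant (punchIn j i) ⟩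
    c′ zero             ≡⟨ constant j ⟨
    c′ j                ≡⟨ insertAt-lookup c j false ⟩
    false               ∎
    where
    open ≡-Reasoning
    c′ : Fin (suc k) → Bool
    c′ = insertAt c j false
    constant : ∀ l → c′ l ≡ c′ zero
    constant = kernel c′ λ a →
      trans (lincomb-punchIn f j c′ (insertAt-lookup c j false) a)
            (trans (Σ₂-cong (λ i → cong (_∧ f (punchIn j i) a) (insertAt-punchIn c j false i)))
                   (c≈0 a))

chr-self : ∀ {n} (s : Fin n) → chr s s ≡ true
chr-self s = trans (isYes≗does (s ≟ s)) (dec-true (s ≟ s) refl)

chr-fromℕ-inject₁ : ∀ {m} (i : Fin m) → chr (fromℕ m) (inject₁ i) ≡ false
chr-fromℕ-inject₁ {m} i = trans (isYes≗does (inject₁ i ≟ fromℕ m))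
                                (dec-false (inject₁ i ≟ fromℕ m) (fromℕ≢inject₁ ∘ sym))

⟨,chr⟩ : ∀ {n} (v : Vec₂ n) s → ⟨ v , chr s ⟩ ≡ v s
⟨,chr⟩ v s = trans (Σ₂-cong (λ a → ∧-comm (v a) (chr s a))) (Σ₂-pick s v)

⌊≟⌋≡toℕ-≡ᵇ : ∀ {n} (a b : Fin n) → ⌊ a ≟ b ⌋ ≡ (toℕ a ≡ᵇ toℕ b)
⌊≟⌋≡toℕ-≡ᵇ zero    zero    = refl
⌊≟⌋≡toℕ-≡ᵇ zero    (suc b) = refl
⌊≟⌋≡toℕ-≡ᵇ (suc a) zero    = refl
⌊≟⌋≡toℕ-≡ᵇ (suc a) (suc b) = trans (⌊⌋-map′ _ _ (a ≟ b)) (⌊≟⌋≡toℕ-≡ᵇ a b)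

flipMove-entry : ∀ {n} (adj : Adj n) → (∀ a → adj a a ≡ false) → ∀ s (v : Vec₂ n) a b →
  (⌊ a ≟ b ⌋ ∨ (⌊ b ≟ s ⌋ ∧ adj a b)) ∧ v b ≡ (⌊ b ≟ a ⌋ ∧ v a) xor (⌊ b ≟ s ⌋ ∧ (adj a s ∧ v s))
flipMove-entry adj loopless s v a b with a ≟ b | b ≟ a | b ≟ s
... | yes refl | yes _   | yes refl rewrite loopless a = sym (xor-identityʳ (v a))
... | yes refl | yes _   | no _     = sym (xor-identityʳ (v a))
... | yes refl | no b≢a  | _        = ⊥-elim (b≢a refl)
... | no a≢b   | yes b≡a | _        = ⊥-elim (a≢b (sym b≡a))
... | no _     | no _    | yes refl = refl
... | no _     | no _    | no _     = refl

flipMove-· : ∀ {n} (adj : Adj n) → (∀ a → adj a a ≡ false) → ∀ s (v : Vec₂ n) a →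
             (flipMove adj s · v) a ≡ v a xor (adj a s ∧ v s)
flipMove-· adj loopless s v a =
  trans (Σ₂-cong (flipMove-entry adj loopless s v a))
        (trans (Σ₂-xor (λ b → ⌊ b ≟ a ⌋ ∧ v a) (λ b → ⌊ b ≟ s ⌋ ∧ (adj a s ∧ v s)))
               (cong₂ _xor_ (Σ₂-pick a (λ _ → v a)) (Σ₂-pick s (λ _ → adj a s ∧ v s))))

bar-suc : ∀ {m} (adj : Adj (suc m)) (k : Fin m) →
          bar adj (suc k) ≡ flipMove adj (inject₁ k) · bar adj (inject₁ k)
bar-suc adj k = cong (λ l → flipMove adj (inject₁ k) · applyFlips adj l (chr zero))
                     (sym (down-inject₁ k))
  where
  down-inject₁ : ∀ {m} (k : Fin m) → down (inject₁ k) ≡ map inject₁ (down k)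
  down-inject₁ zero    = refl
  down-inject₁ (suc k) = cong (λ l → map inject₁ (inject₁ k ∷ l)) (down-inject₁ k)

≡ᵇ-self-xor-suc : ∀ y → (y ≡ᵇ y) xor (y ≡ᵇ suc y) ≡ true
≡ᵇ-self-xor-suc zero    = refl
≡ᵇ-self-xor-suc (suc y) = ≡ᵇ-self-xor-suc y

-- Flipping the path vertex y, whose neighbours on the path are y - 1 and y + 1, turns the
-- vector with path entries at y - 1 and y into the one with entries at y and y + 1.
flip-on-path : ∀ y x → ((y ≡ᵇ x) xor (y ≡ᵇ suc x)) xor ((suc x ≡ᵇ y) ∨ (suc y ≡ᵇ x))
                       ≡ (suc y ≡ᵇ x) xor (y ≡ᵇ x)
flip-on-path zero          zero    = refl
flip-on-path zero          (suc x) = sym (xor-identityʳ _)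
flip-on-path (suc zero)    zero    = refl
flip-on-path (suc (suc y)) zero    = refl
flip-on-path (suc y)       (suc x) = flip-on-path y x

≡ᵇ∨≡ᵇ⇔ : ∀ a b c d → ((a ≡ᵇ b) ∨ (c ≡ᵇ d) ≡ true) ⇔ (a ≡ b ⊎ c ≡ d)
≡ᵇ∨≡ᵇ⇔ a b c d = (≡ᵇ⇔ a b ⊎-⇔ ≡ᵇ⇔ c d) ⇔-∘ (T-∨ ⇔-∘ ⇔-sym T-≡)
  where
  ≡ᵇ⇔ : ∀ x y → T (x ≡ᵇ y) ⇔ (x ≡ y)
  ≡ᵇ⇔ x y = mk⇔ (≡ᵇ⇒≡ x y) (≡⇒≡ᵇ x y)

module _ {m : ℕ} (S : SGraph m) where
  open SGraph S

  adjacent-on-path : ∀ (i k : Fin m) →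
                     adj (inject₁ i) (inject₁ k) ≡ (suc (toℕ i) ≡ᵇ toℕ k) ∨ (suc (toℕ k) ≡ᵇ toℕ i)
  adjacent-on-path i k = ⇔→≡ (⇔-sym (≡ᵇ∨≡ᵇ⇔ _ _ _ _) ⇔-∘ inducedPath i k)

  bar-on-path : ∀ k (i : Fin m) →
                bar adj k (inject₁ i) ≡ (toℕ k ≡ᵇ toℕ i) xor (toℕ k ≡ᵇ suc (toℕ i))
  bar-on-path = <-weakInduction _ base flip-step
    where
    base : ∀ i → bar adj zero (inject₁ i) ≡ (0 ≡ᵇ toℕ i) xor (0 ≡ᵇ suc (toℕ i))
    base zero    = refl
    base (suc i) = refl

    flip-step : ∀ k → (∀ i → bar adj (inject₁ k) (inject₁ i) ≡
                        (toℕ (inject₁ k) ≡ᵇ toℕ i) xor (toℕ (inject₁ k) ≡ᵇ suc (toℕ i))) →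
                 ∀ i → bar adj (suc k) (inject₁ i) ≡
                        (suc (toℕ k) ≡ᵇ toℕ i) xor (toℕ k ≡ᵇ toℕ i)
    flip-step k IH i = begin
      bar adj (suc k) (inject₁ i)
        ≡⟨ cong-app (bar-suc adj k) (inject₁ i) ⟩
      (flipMove adj (inject₁ k) · bar adj (inject₁ k)) (inject₁ i)
        ≡⟨ flipMove-· adj loopless (inject₁ k) (bar adj (inject₁ k)) (inject₁ i) ⟩
      bar adj (inject₁ k) (inject₁ i) xor
        (adj (inject₁ i) (inject₁ k) ∧ bar adj (inject₁ k) (inject₁ k))
        ≡⟨ cong₂ (λ u w → u xor (adj (inject₁ i) (inject₁ k) ∧ w)) (IH i) diagonal ⟩
      ((y′ ≡ᵇ x) xor (y′ ≡ᵇ suc x)) xor (adj (inject₁ i) (inject₁ k) ∧ true)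
        ≡⟨ cong₂ (λ z w → ((z ≡ᵇ x) xor (z ≡ᵇ suc x)) xor w) (toℕ-inject₁ k)
                 (trans (∧-identityʳ _) (adjacent-on-path i k)) ⟩
      ((y ≡ᵇ x) xor (y ≡ᵇ suc x)) xor ((suc x ≡ᵇ y) ∨ (suc y ≡ᵇ x))
        ≡⟨ flip-on-path y x ⟩
      (suc y ≡ᵇ x) xor (y ≡ᵇ x)
        ∎
      where
      open ≡-Reasoning
      x = toℕ i
      y = toℕ k
      y′ = toℕ (inject₁ k)
      diagonal : bar adj (inject₁ k) (inject₁ k) ≡ true
      diagonal = trans (IH k) (trans (cong (λ z → (z ≡ᵇ y) xor (z ≡ᵇ suc y)) (toℕ-inject₁ k))
                                     (≡ᵇ-self-xor-suc y))

  lincomb-on-path : ∀ c (i : Fin m) → lincomb c (bar adj) (inject₁ i) ≡ c (inject₁ i) xor c (suc i)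
  lincomb-on-path c i = begin
    Σ₂ (λ k → c k ∧ bar adj k (inject₁ i))
      ≡⟨ Σ₂-cong (λ k → trans (cong (c k ∧_) (trans (bar-on-path k i) (sym (on-path-δ k))))
                              (trans (∧-comm (c k) _)
                                     (∧-distribʳ-xor (c k) ⌊ k ≟ inject₁ i ⌋ ⌊ k ≟ suc i ⌋))) ⟩
    Σ₂ (λ k → (⌊ k ≟ inject₁ i ⌋ ∧ c k) xor (⌊ k ≟ suc i ⌋ ∧ c k))
      ≡⟨ Σ₂-xor (λ k → ⌊ k ≟ inject₁ i ⌋ ∧ c k) (λ k → ⌊ k ≟ suc i ⌋ ∧ c k) ⟩
    Σ₂ (λ k → ⌊ k ≟ inject₁ i ⌋ ∧ c k) xor Σ₂ (λ k → ⌊ k ≟ suc i ⌋ ∧ c k)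
      ≡⟨ cong₂ _xor_ (Σ₂-pick (inject₁ i) c) (Σ₂-pick (suc i) c) ⟩
    c (inject₁ i) xor c (suc i)
      ∎
    where
    open ≡-Reasoning
    on-path-δ : ∀ k → ⌊ k ≟ inject₁ i ⌋ xor ⌊ k ≟ suc i ⌋ ≡
                      (toℕ k ≡ᵇ toℕ i) xor (toℕ k ≡ᵇ suc (toℕ i))
    on-path-δ k =
      cong₂ _xor_ (trans (⌊≟⌋≡toℕ-≡ᵇ k (inject₁ i)) (cong (toℕ k ≡ᵇ_) (toℕ-inject₁ i)))
                  (⌊≟⌋≡toℕ-≡ᵇ k (suc i))

  constant-if-zero-on-path : ∀ c → (∀ i → lincomb c (bar adj) (inject₁ i) ≡ false) →
                             ∀ k → c k ≡ c zero
  constant-if-zero-on-path c zero-on-path =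
    <-weakInduction _ refl (λ i ci≡c0 → trans (sym (neighbours-equal i)) ci≡c0)
    where
    xor≡false⇒≡ : ∀ {x y} → x xor y ≡ false → x ≡ y
    xor≡false⇒≡ {true}  {true}  _ = refl
    xor≡false⇒≡ {false} {false} _ = refl
    neighbours-equal : ∀ i → c (inject₁ i) ≡ c (suc i)
    neighbours-equal i = xor≡false⇒≡ (trans (sym (lincomb-on-path c i)) (zero-on-path i))

  bar-constantKernel : ConstantKernel (bar adj)
  bar-constantKernel c c≈0 = constant-if-zero-on-path c (c≈0 ∘ inject₁)

  sum-bar-last : lincomb (λ _ → true) (bar adj) (fromℕ m) ≡ parity (card-Π₁ adj)
  sum-bar-last = trans (Σ₂-cong (λ k → sym (⟨,chr⟩ (bar adj k) (fromℕ m))))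
                       (Σ₂≡parity-count (λ k → ⟨ bar adj k , chr (fromℕ m) ⟩))

  sum-bar≈0 : Even (card-Π₁ adj) → lincomb (λ _ → true) (bar adj) ≈ 0v
  sum-bar≈0 even = >-weakInduction _ (trans sum-bar-last (parity-even even))
                                     (λ i _ → lincomb-on-path (λ _ → true) i)

  chr-last∉span : Even (card-Π₁ adj) → ¬ InSpan (bar adj) (chr (fromℕ m))
  chr-last∉span even (c , c≈chr) = false≢true (begin
    false                                             ≡⟨ ∧-zeroʳ (c zero) ⟨
    c zero ∧ false                                    ≡⟨ cong (c zero ∧_) (sum-bar≈0 even (fromℕ m)) ⟨
    c zero ∧ lincomb (λ _ → true) (bar adj) (fromℕ m) ≡⟨ lincomb-constant (bar adj) constant (fromℕ m) ⟨
    lincomb c (bar adj) (fromℕ m)                     ≡⟨ c≈chr (fromℕ m) ⟩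
    chr (fromℕ m) (fromℕ m)                           ≡⟨ chr-self (fromℕ m) ⟩
    true                                              ∎)
    where
    open ≡-Reasoning
    false≢true : false ≡ true → ⊥
    false≢true ()
    constant : ∀ k → c k ≡ c zero
    constant = constant-if-zero-on-path c (λ i → trans (c≈chr (inject₁ i)) (chr-fromℕ-inject₁ i))

proposition3p7 : (m : ℕ) → 1 ≤ m → (S : SGraph m) →
    (Odd (card-Π₁ (SGraph.adj S)) →
      IsBasisOf (InSpan (bar (SGraph.adj S))) (bar (SGraph.adj S)))
    × (Even (card-Π₁ (SGraph.adj S)) →
      ((j : Fin (suc m)) →
        IsBasisOf (InSpan (bar (SGraph.adj S))) (λ i → bar (SGraph.adj S) (punchIn j i)))
      × ¬ InSpan (bar (SGraph.adj S)) (chr (fromℕ m)))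
proposition3p7 m _ S =
  (λ odd → inSpan-member Π ,
           linIndep-of-sum≉0 Π kernel (fromℕ m) (trans (sum-bar-last S) (parity-odd odd)) ,
           (λ _ v∈span → v∈span)) ,
  (λ even → (λ j → inSpan-member Π ∘ punchIn j ,
                   linIndep-punchIn Π kernel j ,
                   (λ _ → inSpan-punchIn Π j (sum-bar≈0 S even))) ,
            chr-last∉span S even)
  where
  Π = bar (SGraph.adj S)
  kernel = bar-constantKernel S
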